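{- Let $\mathcal{D}^h$ be a high-level BAT, $\mathcal{D}^l$ a low-level BAT and $m$ a refinement mapping from $\mathcal{D}^h$ to $\mathcal{D}^l$. If $M_h\models\mathcal{D}^h$, $M_l\models\mathcal{D}^l\cup\mathcal{C}$ and $M_h\sim_m M_l$, then (a) $M_l\models\forall s.\,Do(\textsc{anyseqhl},S_0,s)\supset\bigwedge_{A_i\in\mathcal{A}^h}\forall\vec x.\,\big(m(\phi^{Poss}_{A_i}(\vec x))[s]\equiv\exists s'.\,Do(m(A_i(\vec x)),s,s')\big)$, and (b) $M_l\models\forall s.\,Do(\textsc{anyseqhl},S_0,s)\supset\bigwedge_{A_i\in\mathcal{A}^h}\forall\vec x,s'.\,\Big(Do(m(A_i(\vec x)),s,s')\supset\bigwedge_{F_i\in\mathcal{F}^h}\forall\vec y\,\big(m(\phi^{ssa}_{F_i,A_i}(\vec y,\vec x))[s]\equiv m(F_i(\vec y))[s']\big)\Big)$, where $\phi^{Poss}_{A_i}(\vec x)$ is the (situation-suppressed) right-hand side of the precondition axiom of $A_i(\vec x)$ in $\mathcal{D}^h$, and $\phi^{ssa}_{F_i,A_i}(\vec y,\vec x)$ is the (situation-suppressed) right-hand side of the successor state axiom of $F_i$ in $\mathcal{D}^h$ instantiated with action $A_i(\vec x)$, with action terms eliminated using $\mathcal{D}^h_{ca}$.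
   Context: Situation calculus setting. Objects are a countably infinite set $\mathcal{N}$ of standard names (unique names and domain closure); no function symbols other than constants; no non-fluent predicates. Situations: $S_0$ and $do(a,s)$. $Poss(a,s)$ means $a$ is executable in $s$. A basic action theory (BAT) over finitely many action types $\mathcal{A}$ and fluents $\mathcal{F}$ is the union of: initial-state axioms $\mathcal{D}_{S_0}$; precondition axioms $Poss(A(\vec x),s)\equiv\phi^{Poss}_A(\vec x,s)$; successor state axioms $F(\vec x,do(a,s))\equiv\phi^{ssa}_F(\vec x,a,s)$ (right-hand sides uniform in $s$); $\mathcal{D}_{ca}$, unique names axioms for actions and domain closure on action types; $\mathcal{D}_{coa}$, unique names and domain closure for objects; and the foundational axioms $\Sigma$. A situation-suppressed formula omits situation arguments of fluents; $\phi[s]$ restores $s$. ConGolog programs $\delta::=\alpha\mid\varphi?\mid\delta_1;\delta_2\mid\delta_1|\delta_2\mid\pi x.\delta\mid\delta^*\mid\delta_1\|\delta_2$, $nil=True?$; $\mathcal{C}$ are the axioms: $Trans(\alpha,s,\delta',s')\equiv s'=do(\alpha,s)\land Poss(\alpha,s)\land\delta'=True?$; $Trans(\varphi?,s,\delta',s')\equiv False$; $Trans(\delta_1;\delta_2,s,\delta',s')\equiv\exists\delta_1'(Trans(\delta_1,s,\delta_1',s')\land\delta'=\delta_1';\delta_2)\lor(Final(\delta_1,s)\land Trans(\delta_2,s,\delta',s'))$; $Trans(\delta_1|\delta_2,\cdot)\equiv Trans(\delta_1,\cdot)\lor Trans(\delta_2,\cdot)$; $Trans(\pi x.\delta,s,\delta',s')\equiv\exists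 x.Trans(\delta,s,\delta',s')$; $Trans(\delta^*,s,\delta',s')\equiv\exists\delta''(Trans(\delta,s,\delta'',s')\land\delta'=\delta'';\delta^*)$; $Trans(\delta_1\|\delta_2,s,\delta',s')\equiv\exists\delta_1'(Trans(\delta_1,s,\delta_1',s')\land\delta'=\delta_1'\|\delta_2)\lor\exists\delta_2'(Trans(\delta_2,s,\delta_2',s')\land\delta'=\delta_1\|\delta_2')$; $Final(\alpha,s)\equiv False$; $Final(\varphi?,s)\equiv\varphi[s]$; $Final(\delta_1;\delta_2,s)\equiv Final(\delta_1,s)\land Final(\delta_2,s)$; $Final(\delta_1|\delta_2,s)\equiv Final(\delta_1,s)\lor Final(\delta_2,s)$; $Final(\pi x.\delta,s)\equiv\exists x.Final(\delta,s)$; $Final(\delta^*,s)\equiv True$; $Final(\delta_1\|\delta_2,s)\equiv Final(\delta_1,s)\land Final(\delta_2,s)$. $Do(\delta,s,s')\doteq\exists\delta'.Trans^*(\delta,s,\delta',s')\land Final(\delta',s')$, $Trans^*$ the reflexive transitive closure. $\mathcal{D}^h$ and $\mathcal{D}^l$ have action types $\mathcal{A}^h,\mathcal{A}^l$ and fluents $\mathcal{F}^h,\mathcal{F}^l$, sharing only $\mathcal{N}$. A refinement mapping $m$ maps each $A\in\mathcal{A}^h$ to a situation-determined ConGolog program $m(A(\vec x))$ over $\mathcal{D}^l$ with free variables $\vec x$, and each $F\in\mathcal{F}^h$ to a situation-suppressed low-level formula $m(F(\vec x))$ with free variables $\vec x$; $m(\phi)$ substitutes $m(F(\vec x))$ for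 fluent atoms. For a model $M_h$ of $\mathcal{D}^h$ and a model $M_l$ of $\mathcal{D}^l\cup\mathcal{C}$: $s_h\simeq_m^{M_h,M_l}s_l$ iff for all $F\in\mathcal{F}^h$ and assignments $v$, $M_h,v[s/s_h]\models F(\vec x,s)$ iff $M_l,v[s/s_l]\models m(F(\vec x))[s]$. A relation $B$ between situation domains is an $m$-bisimulation if each $\langle s_h,s_l\rangle\in B$ satisfies: (1) $s_h\simeq_m^{M_h,M_l}s_l$; (2) for each $A\in\mathcal{A}^h$ and $v$, if some $s_h'$ has $M_h,v[s/s_h,s'/s_h']\models Poss(A(\vec x),s)\land s'=do(A(\vec x),s)$ then some $s_l'$ has $M_l,v[s/s_l,s'/s_l']\models Do(m(A(\vec x)),s,s')$ and $\langle s_h',s_l'\rangle\in B$; (3) conversely, if some $s_l'$ has $M_l,v[s/s_l,s'/s_l']\models Do(m(A(\vec x)),s,s')$ then some $s_h'$ has $M_h,v[s/s_h,s'/s_h']\models Poss(A(\vec x),s)\land s'=do(A(\vec x),s)$ and $\langle s_h',s_l'\rangle\in B$. $M_h\sim_m M_l$ iff some $m$-bisimulation contains $\langle S_0^{M_h},S_0^{M_l}\rangle$. $\textsc{any1hl}\doteq|_{A_i\in\mathcal{A}^h}\pi\vec x.\,m(A_i(\vec x))$ and $\textsc{anyseqhl}\doteq\textsc{any1hl}^*$. -}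

module Defs where

open import Data.Nat using (ℕ; zero; suc; _+_)
open import Data.Fin using (Fin; zero; suc)
open import Data.Vec using (Vec; []; _∷_; lookup; map; _++_)
open import Data.List using (List; []; _∷_)
open import Data.Product using (Σ; _×_; _,_)
open import Data.Sum using (_⊎_)
open import Data.Unit using (⊤)
open import Data.Empty using (⊥)
open import Relation.Nullary using (¬_)
open import Relation.Binary.PropositionalEquality using (_≡_)
open import Relation.Binary.Construct.Closure.ReflexiveTransitive using (Star)
open import Function.Bundles using (_⇔_)

-- Signatures: finitely many action types and fluents, each with an arity.
-- Objects are the standard names, represented by ℕ.

record Sig : Set where
  field
    nA  : ℕ
    aAr : Fin nA → ℕ
    nF  : ℕ
    fAr : Fin nF → ℕ
open Sig public

-- Object terms in scope n (well-scoped variables; var zero = innermost).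

data Term (n : ℕ) : Set where
  var : Fin n → Term n
  nm  : ℕ → Term n

-- Situation-suppressed formulas over the fluents of S (no non-fluent
-- predicates, no function symbols), with free variables among Fin n.
data Fm (S : Sig) (n : ℕ) : Set where
  true false : Fm S n
  atom : (F : Fin (nF S)) → Vec (Term n) (fAr S F) → Fm S n
  eq   : Term n → Term n → Fm S n
  not  : Fm S n → Fm S n
  and or imp : Fm S n → Fm S n → Fm S n
  all ex : Fm S (suc n) → Fm S n

Sub : ℕ → ℕ → Set
Sub k n = Fin k → Term n

wkT : ∀ {n} → Term n → Term (suc n)
wkT (var i) = var (suc i)
wkT (nm c)  = nm c

liftS : ∀ {k n} → Sub k n → Sub (suc k) (suc n)
liftS σ zero    = var zero
liftS σ (suc i) = wkT (σ i)

substT : ∀ {k n} → Sub k n → Term k → Term n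
substT σ (var i) = σ i
substT σ (nm c)  = nm c

substF : ∀ {S k n} → Sub k n → Fm S k → Fm S n
substF σ true        = true
substF σ false       = false
substF σ (atom F ts) = atom F (map (substT σ) ts)
substF σ (eq t u)    = eq (substT σ t) (substT σ u)
substF σ (not φ)     = not (substF σ φ)
substF σ (and φ ψ)   = and (substF σ φ) (substF σ ψ)
substF σ (or φ ψ)    = or (substF σ φ) (substF σ ψ)
substF σ (imp φ ψ)   = imp (substF σ φ) (substF σ ψ)
substF σ (all φ)     = all (substF (liftS σ) φ)
substF σ (ex φ)      = ex (substF (liftS σ) φ)

evalT : ∀ {n} → Vec ℕ n → Term n → ℕ
evalT ρ (var i) = lookup ρ i
evalT ρ (nm c)  = c

Interp : Sig → Set₁
Interp S = (F : Fin (nF S)) → Vec ℕ (fAr S F) → Set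

sem : ∀ {S n} → Interp S → Fm S n → Vec ℕ n → Set
sem I true        ρ = ⊤
sem I false       ρ = ⊥
sem I (atom F ts) ρ = I F (map (evalT ρ) ts)
sem I (eq t u)    ρ = evalT ρ t ≡ evalT ρ u
sem I (not φ)     ρ = ¬ sem I φ ρ
sem I (and φ ψ)   ρ = sem I φ ρ × sem I ψ ρ
sem I (or φ ψ)    ρ = sem I φ ρ ⊎ sem I ψ ρ
sem I (imp φ ψ)   ρ = sem I φ ρ → sem I ψ ρ
sem I (all φ)     ρ = (c : ℕ) → sem I φ (c ∷ ρ)
sem I (ex φ)      ρ = Σ ℕ λ c → sem I φ (c ∷ ρ)

-- By D_ca (unique names + domain closure on
-- action types), D_coa and the foundational axioms Σ, the action domain
-- is {A(n⃗)} and situations are finite action sequences; do(a,s) = a ∷ s.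

Action : Sig → Set
Action S = Σ (Fin (nA S)) λ A → Vec ℕ (aAr S A)

Sit : Sig → Set
Sit S = List (Action S)

doA : ∀ {S} → Action S → Sit S → Sit S
doA a s = a ∷ s

S0 : ∀ {S} → Sit S
S0 = []

-- Init       : the initial-state axioms D_S0 (a set of sentences about S0)
--   phiPoss A  : RHS of Poss(A(x⃗),s) ≡ phiPoss A (x⃗)[s]
--   phiSsa F A : RHS of the successor state axiom of F instantiated with
--                action A(x⃗), action terms eliminated using D_ca; free
--                variables y⃗ ++ x⃗ (y⃗ the fluent arguments).

record BAT (S : Sig) : Set₁ where
  field
    Init    : Fm S 0 → Set
    phiPoss : (A : Fin (nA S)) → Fm S (aAr S A)
    phiSsa  : (F : Fin (nF S)) (A : Fin (nA S)) → Fm S (fAr S F + aAr S A)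
open BAT public

-- Object domain = standard names ℕ; situation domain =
-- action sequences; fluents and Poss are interpreted as (proof-relevant)
-- predicates, required to satisfy D_S0, the precondition axioms and the
-- successor state axioms.

holdsAt : ∀ {S n} → ((F : Fin (nF S)) → Vec ℕ (fAr S F) → Sit S → Set)
        → Fm S n → Vec ℕ n → Sit S → Set
holdsAt I φ ρ s = sem (λ F xs → I F xs s) φ ρ

record Model {S : Sig} (D : BAT S) : Set₁ where
  field
    Flu  : (F : Fin (nF S)) → Vec ℕ (fAr S F) → Sit S → Set
    Poss : Action S → Sit S → Set
    init : (φ : Fm S 0) → Init D φ → holdsAt Flu φ [] (S0 {S})
    poss : (A : Fin (nA S)) (xs : Vec ℕ (aAr S A)) (s : Sit S)
         → Poss (A , xs) s ⇔ holdsAt Flu (phiPoss D A) xs s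
    ssa  : (F : Fin (nF S)) (A : Fin (nA S)) (ys : Vec ℕ (fAr S F))
           (xs : Vec ℕ (aAr S A)) (s : Sit S)
         → Flu F ys (doA {S} (A , xs) s) ⇔ holdsAt Flu (phiSsa D F A) (ys ++ xs) s
open Model public

data Prog (S : Sig) (n : ℕ) : Set where
  act  : (A : Fin (nA S)) → Vec (Term n) (aAr S A) → Prog S n
  test : Fm S n → Prog S n
  seq  : Prog S n → Prog S n → Prog S n
  alt  : Prog S n → Prog S n → Prog S n
  pick : Prog S (suc n) → Prog S n          -- π x. δ  (x = var zero)
  star : Prog S n → Prog S n
  conc : Prog S n → Prog S n → Prog S n

nil : ∀ {S n} → Prog S n
nil = test true

substP : ∀ {S k n} → Sub k n → Prog S k → Prog S n
substP σ (act A ts) = act A (map (substT σ) ts)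
substP σ (test φ)   = test (substF σ φ)
substP σ (seq d e)  = seq (substP σ d) (substP σ e)
substP σ (alt d e)  = alt (substP σ d) (substP σ e)
substP σ (pick d)   = pick (substP (liftS σ) d)
substP σ (star d)   = star (substP σ d)
substP σ (conc d e) = conc (substP σ d) (substP σ e)

inst : ∀ {S k} → Vec ℕ k → Prog S k → Prog S 0
inst xs d = substP (λ i → nm (lookup xs i)) d

-- Final and Trans (the axioms C), relative to a model M of a BAT,
-- on closed programs.
module _ {S : Sig} {D : BAT S} (M : Model D) where

  data Final : Prog S 0 → Sit S → Set where
    f-test  : ∀ {φ s} → holdsAt (Flu M) φ [] s → Final (test φ) s
    f-seq   : ∀ {d e s} → Final d s → Final e s → Final (seq d e) s
    f-alt₁  : ∀ {d e s} → Final d s → Final (alt d e) s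
    f-alt₂  : ∀ {d e s} → Final e s → Final (alt d e) s
    f-pick  : ∀ {d s} (c : ℕ) → Final (inst (c ∷ []) d) s → Final (pick d) s
    f-star  : ∀ {d s} → Final (star d) s
    f-conc  : ∀ {d e s} → Final d s → Final e s → Final (conc d e) s

  data Trans : Prog S 0 → Sit S → Prog S 0 → Sit S → Set where
    t-act   : ∀ {A ts s} → Poss M (A , map (evalT []) ts) s
            → Trans (act A ts) s nil (doA {S} (A , map (evalT []) ts) s)
    t-seq₁  : ∀ {d e s d' s'} → Trans d s d' s' → Trans (seq d e) s (seq d' e) s'
    t-seq₂  : ∀ {d e s e' s'} → Final d s → Trans e s e' s' → Trans (seq d e) s e' s'
    t-alt₁  : ∀ {d e s d' s'} → Trans d s d' s' → Trans (alt d e) s d' s'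
    t-alt₂  : ∀ {d e s d' s'} → Trans e s d' s' → Trans (alt d e) s d' s'
    t-pick  : ∀ {d s d' s'} (c : ℕ) → Trans (inst (c ∷ []) d) s d' s'
            → Trans (pick d) s d' s'
    t-star  : ∀ {d s d'' s'} → Trans d s d'' s' → Trans (star d) s (seq d'' (star d)) s'
    t-conc₁ : ∀ {d e s d' s'} → Trans d s d' s' → Trans (conc d e) s (conc d' e) s'
    t-conc₂ : ∀ {d e s e' s'} → Trans e s e' s' → Trans (conc d e) s (conc d e') s'

  Step : Prog S 0 × Sit S → Prog S 0 × Sit S → Set
  Step (d , s) (d' , s') = Trans d s d' s'

  Trans* : Prog S 0 → Sit S → Prog S 0 → Sit S → Set
  Trans* d s d' s' = Star Step (d , s) (d' , s')

  Do : Prog S 0 → Sit S → Sit S → Set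
  Do d s s' = Σ (Prog S 0) λ d' → Trans* d s d' s' × Final d' s'

  SitDetIn : Prog S 0 → Sit S → Set
  SitDetIn d s = ∀ d' d'' s' → Trans* d s d' s' → Trans* d s d'' s' → d' ≡ d''

-- Refinement mappings from Dh (signature Sh) to Dl (signature Sl).
-- Each m(A(x⃗)) must be situation-determined over Dl, i.e. Dl ∪ C ⊨
-- ∀x⃗ ∀s. SD(m(A(x⃗)), s): it holds in every model of Dl.

record Refinement (Sh Sl : Sig) (Dl : BAT Sl) : Set₁ where
  field
    mA : (A : Fin (nA Sh)) → Prog Sl (aAr Sh A)
    mF : (F : Fin (nF Sh)) → Fm Sl (fAr Sh F)
    sd : (A : Fin (nA Sh)) (M : Model Dl) (xs : Vec ℕ (aAr Sh A)) (s : Sit Sl)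
       → SitDetIn M (inst xs (mA A)) s
open Refinement public

mapF : ∀ {Sh Sl Dl n} → Refinement Sh Sl Dl → Fm Sh n → Fm Sl n
mapF m true        = true
mapF m false       = false
mapF m (atom F ts) = substF (λ i → lookup ts i) (mF m F)
mapF m (eq t u)    = eq t u
mapF m (not φ)     = not (mapF m φ)
mapF m (and φ ψ)   = and (mapF m φ) (mapF m ψ)
mapF m (or φ ψ)    = or (mapF m φ) (mapF m ψ)
mapF m (imp φ ψ)   = imp (mapF m φ) (mapF m ψ)
mapF m (all φ)     = all (mapF m φ)
mapF m (ex φ)      = ex (mapF m φ)

-- n-ary nondeterministic choice over a finite index set
-- (the empty choice is False?, which has no transitions and is never final)
choiceFin : ∀ {S} (k : ℕ) → (Fin k → Prog S 0) → Prog S 0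
choiceFin zero          f = test false
choiceFin (suc zero)    f = f zero
choiceFin (suc (suc k)) f = alt (f zero) (choiceFin (suc k) (λ i → f (suc i)))

piAll : ∀ {S} (k : ℕ) → Prog S k → Prog S 0
piAll zero    d = d
piAll (suc k) d = piAll k (pick d)

any1hl : ∀ {Sh Sl Dl} → Refinement Sh Sl Dl → Prog Sl 0
any1hl {Sh} m = choiceFin (nA Sh) (λ A → piAll (aAr Sh A) (mA m A))

anyseqhl : ∀ {Sh Sl Dl} → Refinement Sh Sl Dl → Prog Sl 0
anyseqhl m = star (any1hl m)

module _ {Sh Sl : Sig} {Dh : BAT Sh} {Dl : BAT Sl} (m : Refinement Sh Sl Dl)
         (Mh : Model Dh) (Ml : Model Dl) where

  mIsom : Sit Sh → Sit Sl → Set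
  mIsom sh sl = (F : Fin (nF Sh)) (ys : Vec ℕ (fAr Sh F))
              → Flu Mh F ys sh ⇔ holdsAt (Flu Ml) (mF m F) ys sl

  IsBisim : (Sit Sh → Sit Sl → Set) → Set
  IsBisim B = (sh : Sit Sh) (sl : Sit Sl) → B sh sl →
      mIsom sh sl
    × ((A : Fin (nA Sh)) (xs : Vec ℕ (aAr Sh A)) →
         Poss Mh (A , xs) sh →
         Σ (Sit Sl) λ sl' → Do Ml (inst xs (mA m A)) sl sl' × B (doA {Sh} (A , xs) sh) sl')
    × ((A : Fin (nA Sh)) (xs : Vec ℕ (aAr Sh A)) (sl' : Sit Sl) →
         Do Ml (inst xs (mA m A)) sl sl' →
         Poss Mh (A , xs) sh × B (doA {Sh} (A , xs) sh) sl')

  Bisimilar : Set₁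
  Bisimilar = Σ (Sit Sh → Sit Sl → Set) λ B → IsBisim B × B (S0 {Sh}) (S0 {Sl})

module Submission where

-- Every situation reached by anyseqhl from S0 is m-bisimilar to some high-level situation:
-- an execution of anyseqhl is a sequence of complete runs of programs m(A(x⃗)), and the
-- back condition of the bisimulation carries the relation across each completed run. At a
-- bisimilar pair (s_h , s_l) the m-isomorphism makes m(φ)[s_l] equivalent to φ[s_h], so (a)
-- is the precondition axiom of D^h combined with the forth and back conditions, and (b) is
-- the successor state axiom of D^h at s_h combined with the m-isomorphism at the bisimilar
-- successor of s_h.

open import Defs
open import Data.Fin using (Fin; zero; suc)
open import Data.Vec using (Vec; _++_; []; _∷_; map; lookup)
open import Data.Vec.Properties using (map-∘; map-cong; lookup-map)
open import Data.Nat using (ℕ; zero; suc)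
open import Data.Product using (Σ; _×_; _,_; proj₁; proj₂)
open import Data.Product.Function.NonDependent.Propositional using (_×-⇔_)
import Data.Product.Function.Dependent.Propositional as Dependent
open import Data.Sum.Function.Propositional using (_⊎-⇔_)
open import Function.Bundles using (_⇔_; mk⇔; Equivalence)
open import Function.Properties.Equivalence using ()
  renaming (refl to ⇔-refl; sym to ⇔-sym; trans to ⇔-trans)
open import Function.Related.Propositional using (≡⇒; equivalence)
open import Function.Related.TypeIsomorphisms using (→-cong-⇔; ¬-cong-⇔)
open import Relation.Binary.PropositionalEquality
  using (_≡_; refl; sym; trans; cong; cong₂; subst)
open import Relation.Binary.Construct.Closure.ReflexiveTransitive using (ε; _◅_; _◅◅_)

∀-cong-⇔ : {A : Set} {P Q : A → Set} → (∀ x → P x ⇔ Q x) → (∀ x → P x) ⇔ (∀ x → Q x)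
∀-cong-⇔ P⇔Q = mk⇔ (λ p x → Equivalence.to (P⇔Q x) (p x)) (λ q x → Equivalence.from (P⇔Q x) (q x))

∃-cong-⇔ : {A : Set} {P Q : A → Set} → (∀ x → P x ⇔ Q x) → Σ A P ⇔ Σ A Q
∃-cong-⇔ P⇔Q = Dependent.congˡ {k = equivalence} (λ {x} → P⇔Q x)

wkT-substT : ∀ {k n} (τ : Sub k n) (t : Term k) → substT (liftS τ) (wkT t) ≡ wkT (substT τ t)
wkT-substT τ (var i) = refl
wkT-substT τ (nm c)  = refl

Composite : ∀ {k j n} → Sub k j → Sub j n → Sub k n → Set
Composite σ τ ρ = ∀ i → substT τ (σ i) ≡ ρ i

liftS-Composite : ∀ {k j n} {σ : Sub k j} {τ : Sub j n} {ρ : Sub k n} →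
                  Composite σ τ ρ → Composite (liftS σ) (liftS τ) (liftS ρ)
liftS-Composite στ=ρ zero              = refl
liftS-Composite {σ = σ} {τ} στ=ρ (suc i) = trans (wkT-substT τ (σ i)) (cong wkT (στ=ρ i))

module _ {k j n} {σ : Sub k j} {τ : Sub j n} {ρ : Sub k n} where

  substT-∘ : Composite σ τ ρ → ∀ t → substT τ (substT σ t) ≡ substT ρ t
  substT-∘ στ=ρ (var i) = στ=ρ i
  substT-∘ στ=ρ (nm c)  = refl

  map-substT-∘ : ∀ {l} → Composite σ τ ρ → (ts : Vec (Term k) l) →
                 map (substT τ) (map (substT σ) ts) ≡ map (substT ρ) ts
  map-substT-∘ στ=ρ ts = trans (sym (map-∘ _ _ ts)) (map-cong (substT-∘ στ=ρ) ts)

substF-∘ : ∀ {S k j n} {σ : Sub k j} {τ : Sub j n} {ρ : Sub k n} → Composite σ τ ρ →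
           (φ : Fm S k) → substF τ (substF σ φ) ≡ substF ρ φ
substF-∘ στ=ρ true        = refl
substF-∘ στ=ρ false       = refl
substF-∘ στ=ρ (atom F ts) = cong (atom F) (map-substT-∘ στ=ρ ts)
substF-∘ στ=ρ (eq t u)    = cong₂ eq (substT-∘ στ=ρ t) (substT-∘ στ=ρ u)
substF-∘ στ=ρ (not φ)     = cong not (substF-∘ στ=ρ φ)
substF-∘ στ=ρ (and φ ψ)   = cong₂ and (substF-∘ στ=ρ φ) (substF-∘ στ=ρ ψ)
substF-∘ στ=ρ (or φ ψ)    = cong₂ or (substF-∘ στ=ρ φ) (substF-∘ στ=ρ ψ)
substF-∘ στ=ρ (imp φ ψ)   = cong₂ imp (substF-∘ στ=ρ φ) (substF-∘ στ=ρ ψ)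
substF-∘ στ=ρ (all φ)     = cong all (substF-∘ (liftS-Composite στ=ρ) φ)
substF-∘ στ=ρ (ex φ)      = cong ex (substF-∘ (liftS-Composite στ=ρ) φ)

substP-∘ : ∀ {S k j n} {σ : Sub k j} {τ : Sub j n} {ρ : Sub k n} → Composite σ τ ρ →
           (d : Prog S k) → substP τ (substP σ d) ≡ substP ρ d
substP-∘ στ=ρ (act A ts) = cong (act A) (map-substT-∘ στ=ρ ts)
substP-∘ στ=ρ (test φ)   = cong test (substF-∘ στ=ρ φ)
substP-∘ στ=ρ (seq d e)  = cong₂ seq (substP-∘ στ=ρ d) (substP-∘ στ=ρ e)
substP-∘ στ=ρ (alt d e)  = cong₂ alt (substP-∘ στ=ρ d) (substP-∘ στ=ρ e)
substP-∘ στ=ρ (pick d)   = cong pick (substP-∘ (liftS-Composite στ=ρ) d)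
substP-∘ στ=ρ (star d)   = cong star (substP-∘ στ=ρ d)
substP-∘ στ=ρ (conc d e) = cong₂ conc (substP-∘ στ=ρ d) (substP-∘ στ=ρ e)

Identity : ∀ {n} → Sub n n → Set
Identity σ = ∀ i → σ i ≡ var i

liftS-Identity : ∀ {n} {σ : Sub n n} → Identity σ → Identity (liftS σ)
liftS-Identity σ=id zero    = refl
liftS-Identity σ=id (suc i) = cong wkT (σ=id i)

module _ {n} {σ : Sub n n} where

  substT-id : Identity σ → ∀ t → substT σ t ≡ t
  substT-id σ=id (var i) = σ=id i
  substT-id σ=id (nm c)  = refl

  map-substT-id : ∀ {l} → Identity σ → (ts : Vec (Term n) l) → map (substT σ) ts ≡ ts
  map-substT-id σ=id []       = refl
  map-substT-id σ=id (t ∷ ts) = cong₂ _∷_ (substT-id σ=id t) (map-substT-id σ=id ts)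

substF-id : ∀ {S n} {σ : Sub n n} → Identity σ → (φ : Fm S n) → substF σ φ ≡ φ
substF-id σ=id true        = refl
substF-id σ=id false       = refl
substF-id σ=id (atom F ts) = cong (atom F) (map-substT-id σ=id ts)
substF-id σ=id (eq t u)    = cong₂ eq (substT-id σ=id t) (substT-id σ=id u)
substF-id σ=id (not φ)     = cong not (substF-id σ=id φ)
substF-id σ=id (and φ ψ)   = cong₂ and (substF-id σ=id φ) (substF-id σ=id ψ)
substF-id σ=id (or φ ψ)    = cong₂ or (substF-id σ=id φ) (substF-id σ=id ψ)
substF-id σ=id (imp φ ψ)   = cong₂ imp (substF-id σ=id φ) (substF-id σ=id ψ)
substF-id σ=id (all φ)     = cong all (substF-id (liftS-Identity σ=id) φ)
substF-id σ=id (ex φ)      = cong ex (substF-id (liftS-Identity σ=id) φ)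

substP-id : ∀ {S n} {σ : Sub n n} → Identity σ → (d : Prog S n) → substP σ d ≡ d
substP-id σ=id (act A ts) = cong (act A) (map-substT-id σ=id ts)
substP-id σ=id (test φ)   = cong test (substF-id σ=id φ)
substP-id σ=id (seq d e)  = cong₂ seq (substP-id σ=id d) (substP-id σ=id e)
substP-id σ=id (alt d e)  = cong₂ alt (substP-id σ=id d) (substP-id σ=id e)
substP-id σ=id (pick d)   = cong pick (substP-id (liftS-Identity σ=id) d)
substP-id σ=id (star d)   = cong star (substP-id σ=id d)
substP-id σ=id (conc d e) = cong₂ conc (substP-id σ=id d) (substP-id σ=id e)

evalT-wkT : ∀ {n} (c : ℕ) (ρ : Vec ℕ n) (t : Term n) → evalT (c ∷ ρ) (wkT t) ≡ evalT ρ t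
evalT-wkT c ρ (var i) = refl
evalT-wkT c ρ (nm d)  = refl

Agrees : ∀ {k n} → Sub k n → Vec ℕ n → Vec ℕ k → Set
Agrees σ ρ ρ' = ∀ i → evalT ρ (σ i) ≡ lookup ρ' i

liftS-Agrees : ∀ {k n} {σ : Sub k n} {ρ ρ'} → Agrees σ ρ ρ' → (c : ℕ) →
               Agrees (liftS σ) (c ∷ ρ) (c ∷ ρ')
liftS-Agrees σρ=ρ' c zero = refl
liftS-Agrees {σ = σ} {ρ} σρ=ρ' c (suc i) = trans (evalT-wkT c ρ (σ i)) (σρ=ρ' i)

module _ {k n} {σ : Sub k n} {ρ ρ'} (σρ=ρ' : Agrees σ ρ ρ') where

  evalT-substT : ∀ t → evalT ρ (substT σ t) ≡ evalT ρ' t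
  evalT-substT (var i) = σρ=ρ' i
  evalT-substT (nm c)  = refl

  map-evalT-substT : ∀ {l} (ts : Vec (Term k) l) →
                     map (evalT ρ) (map (substT σ) ts) ≡ map (evalT ρ') ts
  map-evalT-substT ts = trans (sym (map-∘ _ _ ts)) (map-cong evalT-substT ts)

sem-substF : ∀ {S k n} (I : Interp S) {σ : Sub k n} {ρ ρ'} → Agrees σ ρ ρ' →
             (φ : Fm S k) → sem I (substF σ φ) ρ ⇔ sem I φ ρ'
sem-substF I σρ=ρ' true        = ⇔-refl
sem-substF I σρ=ρ' false       = ⇔-refl
sem-substF I σρ=ρ' (atom F ts) = ≡⇒ (cong (I F) (map-evalT-substT σρ=ρ' ts))
sem-substF I σρ=ρ' (eq t u)    =
  ≡⇒ (cong₂ _≡_ (evalT-substT σρ=ρ' t) (evalT-substT σρ=ρ' u))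
sem-substF I σρ=ρ' (not φ)     = ¬-cong-⇔ (sem-substF I σρ=ρ' φ)
sem-substF I σρ=ρ' (and φ ψ)   = sem-substF I σρ=ρ' φ ×-⇔ sem-substF I σρ=ρ' ψ
sem-substF I σρ=ρ' (or φ ψ)    = sem-substF I σρ=ρ' φ ⊎-⇔ sem-substF I σρ=ρ' ψ
sem-substF I σρ=ρ' (imp φ ψ)   = →-cong-⇔ (sem-substF I σρ=ρ' φ) (sem-substF I σρ=ρ' ψ)
sem-substF I σρ=ρ' (all φ)     = ∀-cong-⇔ λ c → sem-substF I (liftS-Agrees σρ=ρ' c) φ
sem-substF I σρ=ρ' (ex φ)      = ∃-cong-⇔ λ c → sem-substF I (liftS-Agrees σρ=ρ' c) φ

sem-mapF : ∀ {Sh Sl Dl n} (m : Refinement Sh Sl Dl) {Ih : Interp Sh} {Il : Interp Sl} →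
           (∀ F ys → Ih F ys ⇔ sem Il (mF m F) ys) →
           (φ : Fm Sh n) (ρ : Vec ℕ n) → sem Ih φ ρ ⇔ sem Il (mapF m φ) ρ
sem-mapF m Ih≃Il true        ρ = ⇔-refl
sem-mapF m Ih≃Il false       ρ = ⇔-refl
sem-mapF m Ih≃Il (atom F ts) ρ = ⇔-trans (Ih≃Il F (map (evalT ρ) ts))
  (⇔-sym (sem-substF _ (λ i → sym (lookup-map i (evalT ρ) ts)) (mF m F)))
sem-mapF m Ih≃Il (eq t u)    ρ = ⇔-refl
sem-mapF m Ih≃Il (not φ)     ρ = ¬-cong-⇔ (sem-mapF m Ih≃Il φ ρ)
sem-mapF m Ih≃Il (and φ ψ)   ρ = sem-mapF m Ih≃Il φ ρ ×-⇔ sem-mapF m Ih≃Il ψ ρ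
sem-mapF m Ih≃Il (or φ ψ)    ρ = sem-mapF m Ih≃Il φ ρ ⊎-⇔ sem-mapF m Ih≃Il ψ ρ
sem-mapF m Ih≃Il (imp φ ψ)   ρ = →-cong-⇔ (sem-mapF m Ih≃Il φ ρ) (sem-mapF m Ih≃Il ψ ρ)
sem-mapF m Ih≃Il (all φ)     ρ = ∀-cong-⇔ λ c → sem-mapF m Ih≃Il φ (c ∷ ρ)
sem-mapF m Ih≃Il (ex φ)      ρ = ∃-cong-⇔ λ c → sem-mapF m Ih≃Il φ (c ∷ ρ)

module _ {S : Sig} {D : BAT S} (M : Model D) where

  choiceFin-Trans : ∀ k (f : Fin k → Prog S 0) {s d' s'} →
                    Trans M (choiceFin k f) s d' s' → Σ (Fin k) λ i → Trans M (f i) s d' s'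
  choiceFin-Trans (suc zero)    f t          = zero , t
  choiceFin-Trans (suc (suc k)) f (t-alt₁ t) = zero , t
  choiceFin-Trans (suc (suc k)) f (t-alt₂ t) with choiceFin-Trans (suc k) (λ i → f (suc i)) t
  ... | i , t' = suc i , t'

  piAll-Trans : ∀ k (d : Prog S k) {s d' s'} →
                Trans M (piAll k d) s d' s' → Σ (Vec ℕ k) λ xs → Trans M (inst xs d) s d' s'
  piAll-Trans zero d {s} {d'} {s'} t =
    [] , subst (λ e → Trans M e s d' s') (sym (substP-id (λ ()) d)) t
  piAll-Trans (suc k) d {s} {d'} {s'} t with piAll-Trans k (pick d) t
  ... | xs , t-pick c t' = c ∷ xs , subst (λ e → Trans M e s d' s') (substP-∘ inst-c∘xs d) t'
    where
    inst-c∘xs : Composite (liftS (λ i → nm (lookup xs i))) (λ i → nm (lookup (c ∷ []) i))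
                          (λ i → nm (lookup (c ∷ xs) i))
    inst-c∘xs zero    = refl
    inst-c∘xs (suc i) = refl

any1hl-Trans : ∀ {Sh Sl Dl} (m : Refinement Sh Sl Dl) (Ml : Model Dl) {s d' s'} →
               Trans Ml (any1hl m) s d' s' →
               Σ (Fin (nA Sh)) λ A → Σ (Vec ℕ (aAr Sh A)) λ xs → Trans Ml (inst xs (mA m A)) s d' s'
any1hl-Trans {Sh} m Ml t with choiceFin-Trans Ml (nA Sh) (λ A → piAll (aAr Sh A) (mA m A)) t
... | A , t' with piAll-Trans Ml (aAr Sh A) (mA m A) t'
... | xs , t'' = A , xs , t''

module Bisimulation {Sh Sl : Sig} {Dh : BAT Sh} {Dl : BAT Sl} (m : Refinement Sh Sl Dl)
  (Mh : Model Dh) (Ml : Model Dl) {B : Sit Sh → Sit Sl → Set} (isB : IsBisim m Mh Ml B) where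

  module _ {sh : Sit Sh} {sl : Sit Sl} (b : B sh sl) where

    isomorphic : mIsom m Mh Ml sh sl
    isomorphic = proj₁ (isB sh sl b)

    forth : (A : Fin (nA Sh)) (xs : Vec ℕ (aAr Sh A)) → Poss Mh (A , xs) sh →
            Σ (Sit Sl) λ sl' → Do Ml (inst xs (mA m A)) sl sl' × B (doA {Sh} (A , xs) sh) sl'
    forth = proj₁ (proj₂ (isB sh sl b))

    back : (A : Fin (nA Sh)) (xs : Vec ℕ (aAr Sh A)) (sl' : Sit Sl) →
           Do Ml (inst xs (mA m A)) sl sl' → Poss Mh (A , xs) sh × B (doA {Sh} (A , xs) sh) sl'
    back = proj₂ (proj₂ (isB sh sl b))

    holdsAt-mapF : ∀ {n} (φ : Fm Sh n) (ρ : Vec ℕ n) →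
                   holdsAt (Flu Mh) φ ρ sh ⇔ holdsAt (Flu Ml) (mapF m φ) ρ sl
    holdsAt-mapF = sem-mapF m isomorphic

  -- Invariant along executions of anyseqhl started at a bisimilar pair.
  data Running : Prog Sl 0 → Sit Sl → Set where
    idle : ∀ {sh sl} → B sh sl → Running (anyseqhl m) sl
    busy : ∀ {sh sl₀ d sl} (A : Fin (nA Sh)) (xs : Vec ℕ (aAr Sh A)) → B sh sl₀ →
           Trans* Ml (inst xs (mA m A)) sl₀ d sl → Running (seq d (anyseqhl m)) sl

  Running-step : ∀ {d s d' s'} → Running d s → Trans Ml d s d' s' → Running d' s'
  Running-step (idle b) (t-star t) with any1hl-Trans m Ml t
  ... | A , xs , t' = busy A xs b (t' ◅ ε)
  Running-step (busy A xs b run) (t-seq₁ t) = busy A xs b (run ◅◅ (t ◅ ε))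
  Running-step (busy {d = d} {sl} A xs b run) (t-seq₂ done (t-star t)) with any1hl-Trans m Ml t
  ... | A' , xs' , t' = busy A' xs' (proj₂ (back b A xs sl (d , run , done))) (t' ◅ ε)

  Running-star : ∀ {d s d' s'} → Running d s → Trans* Ml d s d' s' → Running d' s'
  Running-star r ε        = r
  Running-star r (t ◅ ts) = Running-star (Running-step r t) ts

  Running-final : ∀ {d s} → Running d s → Final Ml d s → Σ (Sit Sh) λ sh → B sh s
  Running-final (idle b)                       _              = _ , b
  Running-final (busy {d = d} {sl} A xs b run) (f-seq done _) =
    _ , proj₂ (back b A xs sl (d , run , done))

  anyseqhl-bisimilar : ∀ {sh sl₀ sl} → B sh sl₀ → Do Ml (anyseqhl m) sl₀ sl →
                       Σ (Sit Sh) λ sh' → B sh' sl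
  anyseqhl-bisimilar b (d , run , done) = Running-final (Running-star (idle b) run) done

  mapF-phiPoss⇔Do : ∀ {sh sl} → B sh sl → (A : Fin (nA Sh)) (xs : Vec ℕ (aAr Sh A)) →
                    holdsAt (Flu Ml) (mapF m (phiPoss Dh A)) xs sl
                      ⇔ Σ (Sit Sl) (λ sl' → Do Ml (inst xs (mA m A)) sl sl')
  mapF-phiPoss⇔Do {sh} {sl} b A xs =
    ⇔-trans (⇔-sym (holdsAt-mapF b (phiPoss Dh A) xs))
    (⇔-trans (⇔-sym (poss Mh A xs sh)) Poss⇔Do)
    where
    Poss⇔Do : Poss Mh (A , xs) sh ⇔ Σ (Sit Sl) (λ sl' → Do Ml (inst xs (mA m A)) sl sl')
    Poss⇔Do = mk⇔ (λ p → let sl' , run , _ = forth b A xs p in sl' , run)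
                  (λ (sl' , run) → proj₁ (back b A xs sl' run))

  mapF-phiSsa⇔mF : ∀ {sh sl} → B sh sl → (A : Fin (nA Sh)) (xs : Vec ℕ (aAr Sh A)) (sl' : Sit Sl) →
                   Do Ml (inst xs (mA m A)) sl sl' → (F : Fin (nF Sh)) (ys : Vec ℕ (fAr Sh F)) →
                   holdsAt (Flu Ml) (mapF m (phiSsa Dh F A)) (ys ++ xs) sl
                     ⇔ holdsAt (Flu Ml) (mF m F) ys sl'
  mapF-phiSsa⇔mF {sh} b A xs sl' run F ys =
    ⇔-trans (⇔-sym (holdsAt-mapF b (phiSsa Dh F A) (ys ++ xs)))
    (⇔-trans (⇔-sym (ssa Mh F A ys xs sh))
    (isomorphic (proj₂ (back b A xs sl' run)) F ys))

lemma3 : {Sh Sl : Sig} (Dh : BAT Sh) (Dl : BAT Sl) (m : Refinement Sh Sl Dl)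
         (Mh : Model Dh) (Ml : Model Dl) → Bisimilar m Mh Ml →
           ((s : Sit Sl) → Do Ml (anyseqhl m) (S0 {Sl}) s →
             (A : Fin (nA Sh)) (xs : Vec ℕ (aAr Sh A)) →
             holdsAt (Flu Ml) (mapF m (phiPoss Dh A)) xs s
               ⇔ Σ (Sit Sl) (λ s' → Do Ml (inst xs (mA m A)) s s'))
         × ((s : Sit Sl) → Do Ml (anyseqhl m) (S0 {Sl}) s →
             (A : Fin (nA Sh)) (xs : Vec ℕ (aAr Sh A)) (s' : Sit Sl) →
             Do Ml (inst xs (mA m A)) s s' →
             (F : Fin (nF Sh)) (ys : Vec ℕ (fAr Sh F)) →
             holdsAt (Flu Ml) (mapF m (phiSsa Dh F A)) (ys ++ xs) s
               ⇔ holdsAt (Flu Ml) (mF m F) ys s')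
lemma3 Dh Dl m Mh Ml (B , isB , b₀) =
  (λ s run → mapF-phiPoss⇔Do (proj₂ (anyseqhl-bisimilar b₀ run))) ,
  (λ s run → mapF-phiSsa⇔mF (proj₂ (anyseqhl-bisimilar b₀ run)))
  where open Bisimulation m Mh Ml isB
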